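{- Let $n\ge2$ and let $\mathcal{X}_n$ be the number of children of the root of a strongly increasing Schröder tree chosen uniformly at random among all strongly increasing Schröder trees with $n$ leaves. Then for $2\le k\le n-1$, \[ \mathbb{P}(\mathcal{X}_n=k)=\frac{2k}{(k+1)!},\qquad\text{and}\qquad \mathbb{P}(\mathcal{X}_n=n)=\frac{2}{n!}. \]
   Context: A Schröder tree is a rooted plane tree (children of each node are ordered) in which every internal node has at least two children; its size is its number of leaves. A strongly increasing Schröder tree is a Schröder tree whose internal nodes carry labels such that, if there are $\ell$ internal nodes, the labels are exactly $1,\dots,\ell$, each used once, and labels strictly increase along every path from the root to a leaf. Leaves are unlabeled. -}

module Defs where

open import Data.Nat using (ℕ; zero; suc; _+_; _≡ᵇ_; _<ᵇ_; _≤ᵇ_)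
open import Data.Bool using (Bool; true; false; _∧_; T; if_then_else_)
open import Data.List using (List; []; _∷_; length; _++_; map; upTo)
open import Data.Product using (Σ; _×_)
open import Relation.Binary.PropositionalEquality using (_≡_)

data Tree : Set where
  leaf : Tree
  node : ℕ → List Tree → Tree

mutual
  leaves : Tree → ℕ
  leaves leaf        = 1
  leaves (node _ ts) = leavesF ts

  leavesF : List Tree → ℕ
  leavesF []       = 0
  leavesF (t ∷ ts) = leaves t + leavesF ts

mutual
  isSchroder : Tree → Bool
  isSchroder leaf        = true
  isSchroder (node _ ts) = (2 ≤ᵇ length ts) ∧ isSchroderF ts

  isSchroderF : List Tree → Bool
  isSchroderF []       = true
  isSchroderF (t ∷ ts) = isSchroder t ∧ isSchroderF ts

above : ℕ → Tree → Bool
above l leaf         = true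
above l (node m _)   = l <ᵇ m

mutual
  isIncreasing : Tree → Bool
  isIncreasing leaf        = true
  isIncreasing (node l ts) = isIncreasingF l ts

  isIncreasingF : ℕ → List Tree → Bool
  isIncreasingF l []       = true
  isIncreasingF l (t ∷ ts) = above l t ∧ isIncreasing t ∧ isIncreasingF l ts

mutual
  labels : Tree → List ℕ
  labels leaf        = []
  labels (node l ts) = l ∷ labelsF ts

  labelsF : List Tree → List ℕ
  labelsF []       = []
  labelsF (t ∷ ts) = labels t ++ labelsF ts

count : ℕ → List ℕ → ℕ
count i []       = 0
count i (x ∷ xs) = if i ≡ᵇ x then suc (count i xs) else count i xs

allB : (ℕ → Bool) → List ℕ → Bool
allB p []       = true
allB p (x ∷ xs) = p x ∧ allB p xs

labelsExact : Tree → Bool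
labelsExact t = allB (λ i → count i (labels t) ≡ᵇ 1) (map suc (upTo (length (labels t))))

isStronglyIncreasingSchroder : Tree → Bool
isStronglyIncreasingSchroder t = isSchroder t ∧ isIncreasing t ∧ labelsExact t

rootDegree : Tree → ℕ
rootDegree leaf        = 0
rootDegree (node _ ts) = length ts

-- the type of strongly increasing Schröder trees with n leaves
-- (the proof components are propositions, so this is a set of trees)
SIST : ℕ → Set
SIST n = Σ Tree (λ t → T (isStronglyIncreasingSchroder t) × leaves t ≡ n)

SISTdeg : ℕ → ℕ → Set
SISTdeg n k = Σ Tree (λ t → T (isStronglyIncreasingSchroder t) × leaves t ≡ n × rootDegree t ≡ k)

-- In a strongly increasing Schröder tree the node with the largest label ℓ has
-- only leaves below it: it is a corolla with d ≥ 2 leaves.  Undoing the last growth step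
-- there keeps the root degree k and removes one leaf: if d = 2 the corolla is pruned to a
-- leaf (whose position among the remaining leaves is recorded), if d > 2 one of its leaves
-- is dropped.  Only the corolla with label 1 and k leaves admits no such step.  So the
-- trees of root degree k with L leaves are in bijection with growth codes (module Codes),
-- whose number c_L satisfies c_k = 1, c_{k+1} = k and c_{L+1} = (L+1)·c_L for L > k,
-- i.e. c_L·(k+1)! = k·L!.  Summing over k ≤ n gives n!/2 trees in total.

module Submission where

open import Defs
open import Data.Nat using (ℕ; zero; suc; _+_; _*_; _∸_; _≤_; _<_; _!; z≤n; s≤s; s≤s⁻¹; _≡ᵇ_; _<ᵇ_; _≤ᵇ_)
open import Data.Nat.Properties
open import Data.Bool using (Bool; true; false; _∧_; T)
open import Data.Bool.Properties using (T-∧; T-irrelevant)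
open import Data.List using (List; []; _∷_; length; _++_; map; upTo; applyUpTo; replicate)
open import Data.List.Properties using (length-++; ++-assoc; ++-identityʳ; map-applyUpTo; length-replicate)
open import Data.Maybe using (Maybe; just; nothing)
open import Data.Maybe.Properties using (just-injective)
open import Axiom.UniquenessOfIdentityProofs.WithK using (uip)
open import Data.Fin as Fin using (Fin; toℕ; fromℕ<)
open import Data.Fin.Properties using (toℕ<n; toℕ-fromℕ<; fromℕ<-toℕ; fromℕ<-cong; +↔⊎; *↔×)
open import Data.Product using (Σ; _×_; _,_; proj₁; proj₂)
open import Data.Sum using (_⊎_; inj₁; inj₂)
open import Data.Sum.Function.Propositional using (_⊎-↔_)
open import Data.Product.Function.NonDependent.Propositional using (_×-↔_)
open import Data.Empty using (⊥; ⊥-elim)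
open import Data.Unit using (tt)
open import Function.Bundles using (_↔_; mk↔ₛ′; Equivalence)
open import Function.Properties.Inverse using (↔-trans; ↔-sym; ↔-refl)
open import Relation.Binary.PropositionalEquality
open import Relation.Nullary using (yes; no)
open import Data.Nat.Solver using (module +-*-Solver)
open +-*-Solver using (solve; _:+_; _:*_; _:=_; con)

∧-intro : ∀ {a b} → T a → T b → T (a ∧ b)
∧-intro p q = Equivalence.from T-∧ (p , q)

∧-fst : ∀ {a b} → T (a ∧ b) → T a
∧-fst {a} {b} p = proj₁ (Equivalence.to (T-∧ {a} {b}) p)

∧-snd : ∀ {a b} → T (a ∧ b) → T b
∧-snd {a} {b} p = proj₂ (Equivalence.to (T-∧ {a} {b}) p)

count-++ : ∀ i xs ys → count i (xs ++ ys) ≡ count i xs + count i ys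
count-++ i []       ys = refl
count-++ i (x ∷ xs) ys with i ≡ᵇ x
... | true  = cong suc (count-++ i xs ys)
... | false = count-++ i xs ys

count-here : ∀ i xs → count i (i ∷ xs) ≡ suc (count i xs)
count-here i xs with i ≡ᵇ i | ≡⇒≡ᵇ i i refl
... | true | _ = refl

count-there : ∀ i x xs → i ≢ x → count i (x ∷ xs) ≡ count i xs
count-there i x xs i≢x with i ≡ᵇ x in eq
... | true  = ⊥-elim (i≢x (≡ᵇ⇒≡ i x (subst T (sym eq) tt)))
... | false = refl

count-∷-pos : ∀ y x xs → 1 ≤ count y (x ∷ xs) → y ≡ x ⊎ 1 ≤ count y xs
count-∷-pos y x xs pos with y ≟ x
... | yes y≡x = inj₁ y≡x
... | no  y≢x = inj₂ (subst (1 ≤_) (count-there y x xs y≢x) pos)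

count-++ˡ : ∀ i xs ys → count i xs ≤ count i (xs ++ ys)
count-++ˡ i xs ys = subst (count i xs ≤_) (sym (count-++ i xs ys)) (m≤m+n _ _)

count-++ʳ : ∀ i xs ys → count i ys ≤ count i (xs ++ ys)
count-++ʳ i xs ys = subst (count i ys ≤_) (sym (count-++ i xs ys)) (m≤n+m _ _)

count-singleton-sym : ∀ i x → count i (x ∷ []) ≡ count x (i ∷ [])
count-singleton-sym i x with i ≟ x
... | yes refl = refl
... | no  i≢x  = trans (count-there i x [] i≢x) (sym (count-there x i [] (λ x≡i → i≢x (sym x≡i))))

sumOver : (ℕ → ℕ) → List ℕ → ℕ
sumOver f []       = 0
sumOver f (x ∷ xs) = f x + sumOver f xs

sumOver-+ : ∀ f g xs → sumOver (λ i → f i + g i) xs ≡ sumOver f xs + sumOver g xs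
sumOver-+ f g []       = refl
sumOver-+ f g (x ∷ xs) rewrite sumOver-+ f g xs =
  solve 4 (λ a b c d → (a :+ b) :+ (c :+ d) := (a :+ c) :+ (b :+ d)) refl (f x) (g x) (sumOver f xs) (sumOver g xs)

sumOver-cong : ∀ {f g} xs → (∀ i → f i ≡ g i) → sumOver f xs ≡ sumOver g xs
sumOver-cong []       f≗g = refl
sumOver-cong (x ∷ xs) f≗g = cong₂ _+_ (f≗g x) (sumOver-cong xs f≗g)

sumOver-zero : ∀ xs → sumOver (λ _ → 0) xs ≡ 0
sumOver-zero []       = refl
sumOver-zero (_ ∷ xs) = sumOver-zero xs

double-count : ∀ S xs → sumOver (λ i → count i xs) S ≡ sumOver (λ x → count x S) xs
double-count S []       = sumOver-zero S
double-count S (x ∷ xs) = begin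
  sumOver (λ i → count i (x ∷ xs)) S
    ≡⟨ sumOver-cong S (λ i → count-++ i (x ∷ []) xs) ⟩
  sumOver (λ i → count i (x ∷ []) + count i xs) S
    ≡⟨ sumOver-+ _ _ S ⟩
  sumOver (λ i → count i (x ∷ [])) S + sumOver (λ i → count i xs) S
    ≡⟨ cong₂ _+_ (single S) (double-count S xs) ⟩
  count x S + sumOver (λ y → count y S) xs ∎
  where
  open ≡-Reasoning
  single : ∀ S → sumOver (λ i → count i (x ∷ [])) S ≡ count x S
  single []      = refl
  single (s ∷ S) = trans (cong₂ _+_ (count-singleton-sym s x) (single S)) (sym (count-++ x (s ∷ []) S))

sumOver-≤-length : ∀ g xs → (∀ x → g x ≤ 1) → sumOver g xs ≤ length xs
sumOver-≤-length g []       g≤1 = z≤n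
sumOver-≤-length g (x ∷ xs) g≤1 = +-mono-≤ (g≤1 x) (sumOver-≤-length g xs g≤1)

sumOver-saturated : ∀ g xs → (∀ x → g x ≤ 1) → sumOver g xs ≡ length xs →
                    ∀ y → 1 ≤ count y xs → g y ≡ 1
sumOver-saturated g (x ∷ xs) g≤1 full y pos with g x in gx | g≤1 x
... | zero  | _ = ⊥-elim (<-irrefl refl (subst (_≤ length xs) full (sumOver-≤-length g xs g≤1)))
... | suc zero | _ with count-∷-pos y x xs pos
...   | inj₁ refl = gx
...   | inj₂ pos′ = sumOver-saturated g xs g≤1 (suc-injective full) y pos′
sumOver-saturated g (x ∷ xs) g≤1 full y pos | suc (suc _) | s≤s ()

interval : ℕ → ℕ → List ℕ
interval a zero    = []
interval a (suc n) = a ∷ interval (suc a) n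

labelRange≡interval : ∀ ℓ → map suc (upTo ℓ) ≡ interval 1 ℓ
labelRange≡interval ℓ = trans (map-applyUpTo (λ i → i) suc ℓ) (applyUpTo-interval suc 1 ℓ (λ i → refl))
  where
  applyUpTo-interval : ∀ (f : ℕ → ℕ) a n → (∀ i → f i ≡ a + i) → applyUpTo f n ≡ interval a n
  applyUpTo-interval f a zero    f≗ = refl
  applyUpTo-interval f a (suc n) f≗ =
    cong₂ _∷_ (trans (f≗ 0) (+-identityʳ a))
              (applyUpTo-interval (λ i → f (suc i)) (suc a) n (λ i → trans (f≗ (suc i)) (+-suc a i)))

length-interval : ∀ a n → length (interval a n) ≡ n
length-interval a zero    = refl
length-interval a (suc n) = cong suc (length-interval (suc a) n)

count-interval-below : ∀ a n x → x < a → count x (interval a n) ≡ 0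
count-interval-below a zero    x x<a = refl
count-interval-below a (suc n) x x<a =
  trans (count-there x a (interval (suc a) n) (<⇒≢ x<a)) (count-interval-below (suc a) n x (m<n⇒m<1+n x<a))

count-interval-≤1 : ∀ a n x → count x (interval a n) ≤ 1
count-interval-≤1 a zero    x = z≤n
count-interval-≤1 a (suc n) x with x ≟ a
... | yes refl = ≤-reflexive (trans (count-here x (interval (suc x) n)) (cong suc (count-interval-below (suc x) n x ≤-refl)))
... | no  x≢a  = subst (_≤ 1) (sym (count-there x a (interval (suc a) n) x≢a)) (count-interval-≤1 (suc a) n x)

count-interval-pos : ∀ a n x → 1 ≤ count x (interval a n) → a ≤ x × x < a + n
count-interval-pos a (suc n) x pos with count-∷-pos x a (interval (suc a) n) pos
... | inj₁ refl = ≤-refl , m<m+n x (s≤s z≤n)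
... | inj₂ pos′ with count-interval-pos (suc a) n x pos′
...   | a<x , x<a+n = <⇒≤ a<x , subst (x <_) (sym (+-suc a n)) x<a+n

allB-interval⁻ : ∀ p a n → T (allB p (interval a n)) → ∀ i → a ≤ i → i < a + n → T (p i)
allB-interval⁻ p a zero    all i a≤i i<a+0 = ⊥-elim (<⇒≱ i<a+0 (≤-trans (≤-reflexive (+-identityʳ a)) a≤i))
allB-interval⁻ p a (suc n) all i a≤i i<a+n with i ≟ a
... | yes refl = ∧-fst all
... | no  i≢a  = allB-interval⁻ p (suc a) n (∧-snd {p a} all) i (≤∧≢⇒< a≤i (λ a≡i → i≢a (sym a≡i)))
                   (subst (i <_) (+-suc a n) i<a+n)

allB-interval⁺ : ∀ p a n → (∀ i → a ≤ i → i < a + n → T (p i)) → T (allB p (interval a n))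
allB-interval⁺ p a zero    all = tt
allB-interval⁺ p a (suc n) all =
  ∧-intro (all a ≤-refl (m<m+n a (s≤s z≤n)))
          (allB-interval⁺ p (suc a) n (λ i a<i i<a+n →
             all i (<⇒≤ a<i) (subst (i <_) (sym (+-suc a n)) i<a+n)))

Exact : List ℕ → Set
Exact xs = ∀ i → 1 ≤ i → i ≤ length xs → count i xs ≡ 1

occursOnce : List ℕ → ℕ → Bool
occursOnce xs i = count i xs ≡ᵇ 1

exact⁻ : ∀ xs → T (allB (occursOnce xs) (map suc (upTo (length xs)))) → Exact xs
exact⁻ xs ok i 1≤i i≤ℓ = ≡ᵇ⇒≡ _ 1 (allB-interval⁻ (occursOnce xs) 1 (length xs) onInterval i 1≤i (s≤s i≤ℓ))
  where onInterval = subst (λ S → T (allB (occursOnce xs) S)) (labelRange≡interval (length xs)) ok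

exact⁺ : ∀ xs → Exact xs → T (allB (occursOnce xs) (map suc (upTo (length xs))))
exact⁺ xs ex = subst (λ S → T (allB (occursOnce xs) S)) (sym (labelRange≡interval (length xs)))
  (allB-interval⁺ (occursOnce xs) 1 (length xs) (λ i 1≤i i<1+ℓ → ≡⇒≡ᵇ _ 1 (ex i 1≤i (s≤s⁻¹ i<1+ℓ))))

-- By double
-- counting, Σ_{x ∈ xs} count x [1..ℓ] = Σ_{i ∈ [1..ℓ]} count i xs = ℓ, and each
-- summand on the left is at most 1, so each equals 1.
exact-bounded : ∀ xs → Exact xs → ∀ y → 1 ≤ count y xs → 1 ≤ y × y ≤ length xs
exact-bounded xs ex y pos with count-interval-pos 1 ℓ y (≤-reflexive (sym inRange))
  where
  ℓ = length xs
  R = interval 1 ℓ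
  sumR : sumOver (λ i → count i xs) R ≡ ℓ
  sumR = ones 1 ℓ ≤-refl (≤-reflexive (+-comm ℓ 1))
    where
    ones : ∀ a n → 1 ≤ a → n + a ≤ suc ℓ → sumOver (λ i → count i xs) (interval a n) ≡ n
    ones a zero    _   _     = refl
    ones a (suc n) 1≤a bound =
      cong₂ _+_ (ex a 1≤a (≤-trans (m≤n+m a n) (s≤s⁻¹ bound)))
                (ones (suc a) n (m≤n⇒m≤1+n 1≤a) (subst (_≤ suc ℓ) (sym (+-suc n a)) bound))
  inRange : count y R ≡ 1
  inRange = sumOver-saturated (λ x → count x R) xs (count-interval-≤1 1 ℓ)
              (trans (sym (double-count R xs)) sumR) y pos
... | 1≤y , y<1+ℓ = 1≤y , s≤s⁻¹ y<1+ℓ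

-- One-hole contexts (zippers).  A frame `frame l ls rs` is a node labelled l whose
-- children are ls, then the hole, then rs; a context lists frames from the root down.
data Frame : Set where
  frame : ℕ → List Tree → List Tree → Frame

Ctx : Set
Ctx = List Frame

plug : Ctx → Tree → Tree
plug []                  x = x
plug (frame l ls rs ∷ C) x = node l (ls ++ plug C x ∷ rs)

labelsBefore : Ctx → List ℕ
labelsBefore []                  = []
labelsBefore (frame l ls rs ∷ C) = l ∷ labelsF ls ++ labelsBefore C

labelsAfter : Ctx → List ℕ
labelsAfter []                  = []
labelsAfter (frame l ls rs ∷ C) = labelsAfter C ++ labelsF rs

ctxLabels : Ctx → List ℕ
ctxLabels C = labelsBefore C ++ labelsAfter C

leavesBefore : Ctx → ℕ
leavesBefore []                  = 0
leavesBefore (frame l ls rs ∷ C) = leavesF ls + leavesBefore C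

leavesAfter : Ctx → ℕ
leavesAfter []                  = 0
leavesAfter (frame l ls rs ∷ C) = leavesAfter C + leavesF rs

labelsF-++ : ∀ xs ys → labelsF (xs ++ ys) ≡ labelsF xs ++ labelsF ys
labelsF-++ []       ys = refl
labelsF-++ (x ∷ xs) ys = trans (cong (labels x ++_) (labelsF-++ xs ys)) (sym (++-assoc (labels x) (labelsF xs) (labelsF ys)))

leavesF-++ : ∀ xs ys → leavesF (xs ++ ys) ≡ leavesF xs + leavesF ys
leavesF-++ []       ys = refl
leavesF-++ (x ∷ xs) ys = trans (cong (leaves x +_) (leavesF-++ xs ys)) (sym (+-assoc (leaves x) (leavesF xs) (leavesF ys)))

labels-plug : ∀ C x → labels (plug C x) ≡ labelsBefore C ++ labels x ++ labelsAfter C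
labels-plug []                  x = sym (++-identityʳ (labels x))
labels-plug (frame l ls rs ∷ C) x = cong (l ∷_) (begin
  labelsF (ls ++ plug C x ∷ rs)
    ≡⟨ labelsF-++ ls (plug C x ∷ rs) ⟩
  labelsF ls ++ labels (plug C x) ++ labelsF rs
    ≡⟨ cong (λ z → labelsF ls ++ z ++ labelsF rs) (labels-plug C x) ⟩
  labelsF ls ++ (B ++ labels x ++ A) ++ labelsF rs
    ≡⟨ cong (labelsF ls ++_) (trans (++-assoc B _ (labelsF rs)) (cong (B ++_) (++-assoc (labels x) A (labelsF rs)))) ⟩
  labelsF ls ++ B ++ labels x ++ A ++ labelsF rs
    ≡⟨ sym (++-assoc (labelsF ls) B _) ⟩
  (labelsF ls ++ B) ++ labels x ++ A ++ labelsF rs ∎)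
  where
  open ≡-Reasoning
  B = labelsBefore C
  A = labelsAfter C

leaves-plug : ∀ C x → leaves (plug C x) ≡ leavesBefore C + (leaves x + leavesAfter C)
leaves-plug []                  x = sym (+-identityʳ (leaves x))
leaves-plug (frame l ls rs ∷ C) x = begin
  leavesF (ls ++ plug C x ∷ rs)
    ≡⟨ leavesF-++ ls (plug C x ∷ rs) ⟩
  leavesF ls + (leaves (plug C x) + leavesF rs)
    ≡⟨ cong (λ z → leavesF ls + (z + leavesF rs)) (leaves-plug C x) ⟩
  leavesF ls + (leavesBefore C + (leaves x + leavesAfter C) + leavesF rs)
    ≡⟨ solve 5 (λ a b c d e → a :+ (b :+ (c :+ d) :+ e) := (a :+ b) :+ (c :+ (d :+ e))) refl
               (leavesF ls) (leavesBefore C) (leaves x) (leavesAfter C) (leavesF rs) ⟩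
  leavesF ls + leavesBefore C + (leaves x + (leavesAfter C + leavesF rs)) ∎
  where open ≡-Reasoning

count-plug : ∀ i C x → count i (labels (plug C x)) ≡ count i (ctxLabels C) + count i (labels x)
count-plug i C x = begin
  count i (labels (plug C x))
    ≡⟨ cong (count i) (labels-plug C x) ⟩
  count i (B ++ labels x ++ A)
    ≡⟨ trans (count-++ i B _) (cong (count i B +_) (count-++ i (labels x) A)) ⟩
  count i B + (count i (labels x) + count i A)
    ≡⟨ solve 3 (λ a b c → a :+ (b :+ c) := (a :+ c) :+ b) refl (count i B) (count i (labels x)) (count i A) ⟩
  count i B + count i A + count i (labels x)
    ≡⟨ cong (_+ count i (labels x)) (sym (count-++ i B A)) ⟩
  count i (ctxLabels C) + count i (labels x) ∎
  where
  open ≡-Reasoning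
  B = labelsBefore C
  A = labelsAfter C

length-labels-plug : ∀ C x → length (labels (plug C x)) ≡ length (ctxLabels C) + length (labels x)
length-labels-plug C x = begin
  length (labels (plug C x))
    ≡⟨ cong length (labels-plug C x) ⟩
  length (B ++ labels x ++ A)
    ≡⟨ trans (length-++ B) (cong (length B +_) (length-++ (labels x))) ⟩
  length B + (length (labels x) + length A)
    ≡⟨ solve 3 (λ a b c → a :+ (b :+ c) := (a :+ c) :+ b) refl (length B) (length (labels x)) (length A) ⟩
  length B + length A + length (labels x)
    ≡⟨ cong (_+ length (labels x)) (sym (length-++ B)) ⟩
  length (ctxLabels C) + length (labels x) ∎
  where
  open ≡-Reasoning
  B = labelsBefore C
  A = labelsAfter C

leavesBefore<leaves : ∀ C → leavesBefore C < leaves (plug C leaf)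
leavesBefore<leaves C = subst (leavesBefore C <_) (sym (leaves-plug C leaf)) (m<m+n (leavesBefore C) (s≤s z≤n))

count-++-zero : ∀ i xs ys → count i (xs ++ ys) ≡ 0 → count i xs ≡ 0 × count i ys ≡ 0
count-++-zero i xs ys none = m+n≡0⇒m≡0 _ sum≡0 , m+n≡0⇒n≡0 (count i xs) sum≡0
  where sum≡0 = trans (sym (count-++ i xs ys)) none

-- The context of the p-th leaf of a tree (leaves numbered 0, 1, … from the left).
mutual
  locateLeaf : ℕ → Tree → Ctx
  locateLeaf p leaf        = []
  locateLeaf p (node l ts) = locateLeafF l [] p ts

  -- the p-th leaf among the children ts of a node l, the children `done` preceding ts
  locateLeafF : ℕ → List Tree → ℕ → List Tree → Ctx
  locateLeafF l done p []       = []
  locateLeafF l done p (t ∷ ts) with p <? leaves t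
  ... | yes _ = frame l done ts ∷ locateLeaf p t
  ... | no  _ = locateLeafF l (done ++ t ∷ []) (p ∸ leaves t) ts

mutual
  locateLeaf-spec : ∀ p t → p < leaves t →
                    plug (locateLeaf p t) leaf ≡ t × leavesBefore (locateLeaf p t) ≡ p
  locateLeaf-spec zero    leaf        _         = refl , refl
  locateLeaf-spec (suc p) leaf        (s≤s ())
  locateLeaf-spec p       (node l ts) p<leaves = locateLeafF-spec l [] p ts p<leaves

  locateLeafF-spec : ∀ l done p ts → p < leavesF ts →
                     plug (locateLeafF l done p ts) leaf ≡ node l (done ++ ts)
                     × leavesBefore (locateLeafF l done p ts) ≡ leavesF done + p
  locateLeafF-spec l done p (t ∷ ts) p<leaves with p <? leaves t
  ... | yes p<t with locateLeaf-spec p t p<t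
  ...   | plugged , before = cong (λ z → node l (done ++ z ∷ ts)) plugged , cong (leavesF done +_) before
  locateLeafF-spec l done p (t ∷ ts) p<leaves | no p≮t
    with locateLeafF-spec l (done ++ t ∷ []) (p ∸ leaves t) ts rest<
    where
    rest< : p ∸ leaves t < leavesF ts
    rest< = +-cancelˡ-< (leaves t) _ _ (subst (_< leaves t + leavesF ts) (sym (m+[n∸m]≡n (≮⇒≥ p≮t))) p<leaves)
  ... | plugged , before = trans plugged (cong (node l) (++-assoc done (t ∷ []) ts)) , (begin
    leavesBefore (locateLeafF l (done ++ t ∷ []) (p ∸ leaves t) ts)
      ≡⟨ before ⟩
    leavesF (done ++ t ∷ []) + (p ∸ leaves t)
      ≡⟨ cong (_+ (p ∸ leaves t)) (trans (leavesF-++ done (t ∷ [])) (cong (leavesF done +_) (+-identityʳ (leaves t)))) ⟩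
    leavesF done + leaves t + (p ∸ leaves t)
      ≡⟨ +-assoc (leavesF done) (leaves t) _ ⟩
    leavesF done + (leaves t + (p ∸ leaves t))
      ≡⟨ cong (leavesF done +_) (m+[n∸m]≡n (≮⇒≥ p≮t)) ⟩
    leavesF done + p ∎)
    where open ≡-Reasoning

locateLeafF-plug : ∀ l done ls q y rs → q < leaves y →
                   locateLeafF l done (leavesF ls + q) (ls ++ y ∷ rs) ≡ frame l (done ++ ls) rs ∷ locateLeaf q y
locateLeafF-plug l done [] q y rs q<y with q <? leaves y
... | yes _   = cong (λ z → frame l z rs ∷ locateLeaf q y) (sym (++-identityʳ done))
... | no  q≮y = ⊥-elim (q≮y q<y)
locateLeafF-plug l done (t ∷ ls) q y rs q<y with leaves t + leavesF ls + q <? leaves t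
... | yes too-small = ⊥-elim (<⇒≱ too-small (≤-trans (m≤m+n (leaves t) (leavesF ls)) (m≤m+n _ q)))
... | no  _         = begin
  locateLeafF l (done ++ t ∷ []) (leaves t + leavesF ls + q ∸ leaves t) (ls ++ y ∷ rs)
    ≡⟨ cong (λ z → locateLeafF l (done ++ t ∷ []) z (ls ++ y ∷ rs))
            (trans (cong (_∸ leaves t) (+-assoc (leaves t) (leavesF ls) q)) (m+n∸m≡n (leaves t) _)) ⟩
  locateLeafF l (done ++ t ∷ []) (leavesF ls + q) (ls ++ y ∷ rs)
    ≡⟨ locateLeafF-plug l (done ++ t ∷ []) ls q y rs q<y ⟩
  frame l ((done ++ t ∷ []) ++ ls) rs ∷ locateLeaf q y
    ≡⟨ cong (λ z → frame l z rs ∷ locateLeaf q y) (++-assoc done (t ∷ []) ls) ⟩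
  frame l (done ++ t ∷ ls) rs ∷ locateLeaf q y ∎
  where open ≡-Reasoning

locateLeaf-plug : ∀ C → locateLeaf (leavesBefore C) (plug C leaf) ≡ C
locateLeaf-plug []                  = refl
locateLeaf-plug (frame l ls rs ∷ C) =
  trans (locateLeafF-plug l [] ls (leavesBefore C) (plug C leaf) rs (leavesBefore<leaves C))
        (cong (frame l ls rs ∷_) (locateLeaf-plug C))

Found : Set
Found = Maybe (Ctx × List Tree)

underFrame : Frame → Found → Found → Found
underFrame f (just (C , us)) _    = just (f ∷ C , us)
underFrame f nothing         rest = rest

mutual
  findLabel : ℕ → Tree → Found
  findLabel ℓ leaf        = nothing
  findLabel ℓ (node l ts) with l ≟ ℓ
  ... | yes _ = just ([] , ts)
  ... | no  _ = findLabelF ℓ l [] ts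

  findLabelF : ℕ → ℕ → List Tree → List Tree → Found
  findLabelF ℓ l done []       = nothing
  findLabelF ℓ l done (t ∷ ts) = underFrame (frame l done ts) (findLabel ℓ t) (findLabelF ℓ l (done ++ t ∷ []) ts)

mutual
  findLabel-sound : ∀ ℓ t C us → findLabel ℓ t ≡ just (C , us) → t ≡ plug C (node ℓ us)
  findLabel-sound ℓ (node l ts) C us found with l ≟ ℓ
  findLabel-sound ℓ (node l ts) .[] .ts refl | yes refl = refl
  ... | no _ = findLabelF-sound ℓ l [] ts C us found

  findLabelF-sound : ∀ ℓ l done ts C us → findLabelF ℓ l done ts ≡ just (C , us) →
                     node l (done ++ ts) ≡ plug C (node ℓ us)
  findLabelF-sound ℓ l done (t ∷ ts) C us found with findLabel ℓ t in inT
  findLabelF-sound ℓ l done (t ∷ ts) .(frame l done ts ∷ C′) .us′ refl | just (C′ , us′) =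
    cong (λ z → node l (done ++ z ∷ ts)) (findLabel-sound ℓ t C′ us′ inT)
  ... | nothing =
    trans (cong (node l) (sym (++-assoc done (t ∷ []) ts))) (findLabelF-sound ℓ l (done ++ t ∷ []) ts C us found)

mutual
  findLabel-complete : ∀ ℓ t → findLabel ℓ t ≡ nothing → count ℓ (labels t) ≡ 0
  findLabel-complete ℓ leaf        _       = refl
  findLabel-complete ℓ (node l ts) missing with l ≟ ℓ
  ... | no l≢ℓ = trans (count-there ℓ l (labelsF ts) (λ ℓ≡l → l≢ℓ (sym ℓ≡l))) (findLabelF-complete ℓ l [] ts missing)

  findLabelF-complete : ∀ ℓ l done ts → findLabelF ℓ l done ts ≡ nothing → count ℓ (labelsF ts) ≡ 0
  findLabelF-complete ℓ l done []       _       = refl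
  findLabelF-complete ℓ l done (t ∷ ts) missing with findLabel ℓ t in inT
  ... | nothing = trans (count-++ ℓ (labels t) (labelsF ts))
                        (cong₂ _+_ (findLabel-complete ℓ t inT) (findLabelF-complete ℓ l (done ++ t ∷ []) ts missing))

count-label-plug : ∀ C ℓ us → 1 ≤ count ℓ (labels (plug C (node ℓ us)))
count-label-plug C ℓ us = subst (1 ≤_) (sym (count-plug ℓ C (node ℓ us)))
  (≤-trans (subst (1 ≤_) (sym (count-here ℓ (labelsF us))) (s≤s z≤n)) (m≤n+m _ _))

findLabel-absent : ∀ ℓ t → count ℓ (labels t) ≡ 0 → findLabel ℓ t ≡ nothing
findLabel-absent ℓ t none with findLabel ℓ t in inT
... | nothing       = refl
... | just (C , us) = ⊥-elim (<⇒≢ (subst (λ z → 1 ≤ count ℓ (labels z)) (sym (findLabel-sound ℓ t C us inT))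
                                                (count-label-plug C ℓ us)) (sym none))

findLabelF-skip : ∀ ℓ l done ls y rs → count ℓ (labelsF ls) ≡ 0 →
  findLabelF ℓ l done (ls ++ y ∷ rs)
    ≡ underFrame (frame l (done ++ ls) rs) (findLabel ℓ y) (findLabelF ℓ l ((done ++ ls) ++ y ∷ []) rs)
findLabelF-skip ℓ l done []       y rs _ rewrite ++-identityʳ done = refl
findLabelF-skip ℓ l done (t ∷ ls) y rs none
  with count-++-zero ℓ (labels t) (labelsF ls) none
... | noneT , noneLs
  rewrite findLabel-absent ℓ t noneT
        | findLabelF-skip ℓ l (done ++ t ∷ []) ls y rs noneLs
        | ++-assoc done (t ∷ []) ls = refl

findLabel-plug : ∀ ℓ C us → count ℓ (ctxLabels C) ≡ 0 → findLabel ℓ (plug C (node ℓ us)) ≡ just (C , us)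
findLabel-plug ℓ [] us _ with ℓ ≟ ℓ
... | yes _   = refl
... | no  ℓ≢ℓ = ⊥-elim (ℓ≢ℓ refl)
findLabel-plug ℓ (frame l ls rs ∷ C) us none with l ≟ ℓ
... | yes refl = ⊥-elim (1+n≢0 (trans (sym (count-here l rest)) none))
  where rest = (labelsF ls ++ labelsBefore C) ++ labelsAfter C ++ labelsF rs
... | no  l≢ℓ  =
  trans (findLabelF-skip ℓ l [] ls (plug C (node ℓ us)) rs noneLs)
        (cong (λ m → underFrame (frame l ls rs) m (findLabelF ℓ l (ls ++ plug C (node ℓ us) ∷ []) rs))
              (findLabel-plug ℓ C us noneC))
  where
  rest = count-++-zero ℓ (labelsF ls ++ labelsBefore C) (labelsAfter C ++ labelsF rs)
           (trans (sym (count-there ℓ l ((labelsF ls ++ labelsBefore C) ++ labelsAfter C ++ labelsF rs) (λ ℓ≡l → l≢ℓ (sym ℓ≡l)))) none)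
  before = count-++-zero ℓ (labelsF ls) (labelsBefore C) (proj₁ rest)
  after  = count-++-zero ℓ (labelsAfter C) (labelsF rs) (proj₂ rest)
  noneLs : count ℓ (labelsF ls) ≡ 0
  noneLs = proj₁ before
  noneC : count ℓ (ctxLabels C) ≡ 0
  noneC = trans (count-++ ℓ (labelsBefore C) (labelsAfter C)) (cong₂ _+_ (proj₂ before) (proj₁ after))

-- Replacing the subtree at the hole of a context.  The Schröder condition is local,
-- so it survives any replacement by a Schröder tree.
isSchroderF-hole : ∀ ls rs a → T (isSchroderF (ls ++ a ∷ rs)) → T (isSchroder a)
isSchroderF-hole []       rs a ok = ∧-fst ok
isSchroderF-hole (x ∷ ls) rs a ok = isSchroderF-hole ls rs a (∧-snd {isSchroder x} ok)

isSchroderF-replace : ∀ ls rs a b → T (isSchroderF (ls ++ a ∷ rs)) → T (isSchroder b) → T (isSchroderF (ls ++ b ∷ rs))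
isSchroderF-replace []       rs a b ok okb = ∧-intro okb (∧-snd {isSchroder a} ok)
isSchroderF-replace (x ∷ ls) rs a b ok okb = ∧-intro {isSchroder x} (∧-fst {isSchroder x} ok) (isSchroderF-replace ls rs a b (∧-snd {isSchroder x} ok) okb)

schroder-subtree : ∀ C x → T (isSchroder (plug C x)) → T (isSchroder x)
schroder-subtree []                  x ok = ok
schroder-subtree (frame l ls rs ∷ C) x ok = schroder-subtree C x (isSchroderF-hole ls rs (plug C x) (∧-snd {2 ≤ᵇ length (ls ++ plug C x ∷ rs)} ok))

schroder-replace : ∀ C x y → T (isSchroder (plug C x)) → T (isSchroder y) → T (isSchroder (plug C y))
schroder-replace []                  x y ok oky = oky
schroder-replace (frame l ls rs ∷ C) x y ok oky =
  ∧-intro {2 ≤ᵇ length (ls ++ plug C y ∷ rs)}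
          (subst (λ n → T (2 ≤ᵇ n)) (trans (length-++ ls) (sym (length-++ ls))) (∧-fst {2 ≤ᵇ length (ls ++ plug C x ∷ rs)} ok))
          (isSchroderF-replace ls rs (plug C x) (plug C y) children
            (schroder-replace C x y (isSchroderF-hole ls rs (plug C x) children) oky))
  where children = ∧-snd {2 ≤ᵇ length (ls ++ plug C x ∷ rs)} ok

-- The increasing condition is local too, except for the edge from the hole's parent:
-- `fitsHole C y` says that y's root label exceeds the label of the hole's parent.
fitsHole : Ctx → Tree → Bool
fitsHole []                    y = true
fitsHole (frame l _ _ ∷ [])    y = above l y
fitsHole (frame _ _ _ ∷ f ∷ C) y = fitsHole (f ∷ C) y

isIncreasingF-hole : ∀ l ls rs a → T (isIncreasingF l (ls ++ a ∷ rs)) → T (above l a) × T (isIncreasing a)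
isIncreasingF-hole l []       rs a ok = ∧-fst ok , ∧-fst (∧-snd {above l a} ok)
isIncreasingF-hole l (x ∷ ls) rs a ok = isIncreasingF-hole l ls rs a (∧-snd {isIncreasing x} (∧-snd {above l x} ok))

isIncreasingF-replace : ∀ l ls rs a b → T (isIncreasingF l (ls ++ a ∷ rs)) → T (above l b) → T (isIncreasing b) →
                        T (isIncreasingF l (ls ++ b ∷ rs))
isIncreasingF-replace l []       rs a b ok edge okb =
  ∧-intro {above l b} edge (∧-intro {isIncreasing b} okb (∧-snd {isIncreasing a} (∧-snd {above l a} ok)))
isIncreasingF-replace l (x ∷ ls) rs a b ok edge okb =
  ∧-intro {above l x} (∧-fst {above l x} ok) (∧-intro {isIncreasing x} (∧-fst {isIncreasing x} (∧-snd {above l x} ok))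
    (isIncreasingF-replace l ls rs a b (∧-snd {isIncreasing x} (∧-snd {above l x} ok)) edge okb))

increasing-subtree : ∀ C x → T (isIncreasing (plug C x)) → T (isIncreasing x)
increasing-subtree []                  x ok = ok
increasing-subtree (frame l ls rs ∷ C) x ok = increasing-subtree C x (proj₂ (isIncreasingF-hole l ls rs (plug C x) ok))

increasing-fits : ∀ C x → T (isIncreasing (plug C x)) → T (fitsHole C x)
increasing-fits []                      x ok = tt
increasing-fits (frame l ls rs ∷ [])    x ok = proj₁ (isIncreasingF-hole l ls rs x ok)
increasing-fits (frame l ls rs ∷ f ∷ C) x ok = increasing-fits (f ∷ C) x (proj₂ (isIncreasingF-hole l ls rs _ ok))

increasing-replace : ∀ C x y → T (isIncreasing (plug C x)) → T (isIncreasing y) → T (fitsHole C y) →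
                     T (isIncreasing (plug C y))
increasing-replace []                      x y ok oky fits = oky
increasing-replace (frame l ls rs ∷ [])    x y ok oky fits = isIncreasingF-replace l ls rs x y ok fits oky
increasing-replace (frame l ls rs ∷ frame l′ ls′ rs′ ∷ C) x y ok oky fits =
  isIncreasingF-replace l ls rs _ _ ok (proj₁ (isIncreasingF-hole l ls rs _ ok))
    (increasing-replace (frame l′ ls′ rs′ ∷ C) x y (proj₂ (isIncreasingF-hole l ls rs _ ok)) oky fits)

fitsHole-root : ∀ C l a b → fitsHole C (node l a) ≡ fitsHole C (node l b)
fitsHole-root []                    l a b = refl
fitsHole-root (frame _ _ _ ∷ [])    l a b = refl
fitsHole-root (frame _ _ _ ∷ f ∷ C) l a b = fitsHole-root (f ∷ C) l a b

fitsHole-leaf : ∀ C → T (fitsHole C leaf)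
fitsHole-leaf []                    = tt
fitsHole-leaf (frame _ _ _ ∷ [])    = tt
fitsHole-leaf (frame _ _ _ ∷ f ∷ C) = fitsHole-leaf (f ∷ C)

fitsHole-above : ∀ C ℓ us → (∀ m → 1 ≤ count m (labelsBefore C) → m < ℓ) → T (fitsHole C (node ℓ us))
fitsHole-above []                      ℓ us below = tt
fitsHole-above (frame l ls rs ∷ [])    ℓ us below = <⇒<ᵇ (below l (subst (1 ≤_) (sym (count-here l (labelsF ls ++ []))) (s≤s z≤n)))
fitsHole-above (frame l ls rs ∷ f ∷ C) ℓ us below = fitsHole-above (f ∷ C) ℓ us
  (λ m pos → below m (≤-trans pos (count-++ʳ m (l ∷ labelsF ls) (labelsBefore (f ∷ C)))))

record Valid (t : Tree) : Set where
  constructor valid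
  field
    schroder   : T (isSchroder t)
    increasing : T (isIncreasing t)
    exact      : Exact (labels t)
open Valid

toValid : ∀ {t} → T (isStronglyIncreasingSchroder t) → Valid t
toValid {t} ok = valid (∧-fst {isSchroder t} ok) (∧-fst {isIncreasing t} rest) (exact⁻ (labels t) (∧-snd {isIncreasing t} rest))
  where rest = ∧-snd {isSchroder t} ok

fromValid : ∀ {t} → Valid t → T (isStronglyIncreasingSchroder t)
fromValid {t} (valid sch inc ex) = ∧-intro {isSchroder t} sch (∧-intro {isIncreasing t} inc (exact⁺ (labels t) ex))

-- The number of internal nodes, i.e. the largest label of a valid tree.
internal : Tree → ℕ
internal t = length (labels t)

valid-bounded : ∀ {t} → Valid t → ∀ y → 1 ≤ count y (labels t) → 1 ≤ y × y ≤ internal t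
valid-bounded {t} v = exact-bounded (labels t) (exact v)

corolla : ℕ → ℕ → Tree
corolla ℓ d = node ℓ (replicate d leaf)

labels-corolla : ∀ ℓ d → labels (corolla ℓ d) ≡ ℓ ∷ []
labels-corolla ℓ zero    = refl
labels-corolla ℓ (suc d) = labels-corolla ℓ d

leaves-corolla : ∀ ℓ d → leaves (corolla ℓ d) ≡ d
leaves-corolla ℓ zero    = refl
leaves-corolla ℓ (suc d) = cong suc (leaves-corolla ℓ d)

rootDegree-corolla : ∀ ℓ d → rootDegree (corolla ℓ d) ≡ d
rootDegree-corolla ℓ d = length-replicate d

isIncreasing-corolla : ∀ ℓ d → T (isIncreasing (corolla ℓ d))
isIncreasing-corolla ℓ zero    = tt
isIncreasing-corolla ℓ (suc d) = isIncreasing-corolla ℓ d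

isSchroder-corolla : ∀ ℓ d → 2 ≤ d → T (isSchroder (corolla ℓ d))
isSchroder-corolla ℓ d 2≤d =
  ∧-intro {2 ≤ᵇ length (replicate d leaf)} (subst (λ n → T (2 ≤ᵇ n)) (sym (length-replicate d)) (≤⇒≤ᵇ 2≤d)) (leavesSchroder d)
  where
  leavesSchroder : ∀ d → T (isSchroderF (replicate d leaf))
  leavesSchroder zero    = tt
  leavesSchroder (suc d) = leavesSchroder d

isSchroder-corolla⁻ : ∀ ℓ d → T (isSchroder (corolla ℓ d)) → 2 ≤ d
isSchroder-corolla⁻ ℓ d ok = subst (2 ≤_) (length-replicate d) (≤ᵇ⇒≤ 2 _ (∧-fst {2 ≤ᵇ length (replicate d leaf)} ok))

internal-corolla-plug : ∀ C ℓ d → internal (plug C (corolla ℓ d)) ≡ suc (internal (plug C leaf))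
internal-corolla-plug C ℓ d = begin
  internal (plug C (corolla ℓ d))            ≡⟨ length-labels-plug C (corolla ℓ d) ⟩
  length (ctxLabels C) + length (labels (corolla ℓ d)) ≡⟨ cong (λ z → length (ctxLabels C) + length z) (labels-corolla ℓ d) ⟩
  length (ctxLabels C) + 1                   ≡⟨ +-comm (length (ctxLabels C)) 1 ⟩
  suc (length (ctxLabels C))                 ≡⟨ cong suc (sym (trans (length-labels-plug C leaf) (+-identityʳ _))) ⟩
  suc (internal (plug C leaf)) ∎
  where open ≡-Reasoning

count-corolla-plug : ∀ i C ℓ d → count i (labels (plug C (corolla ℓ d))) ≡ count i (labels (plug C leaf)) + count i (ℓ ∷ [])
count-corolla-plug i C ℓ d = begin
  count i (labels (plug C (corolla ℓ d)))       ≡⟨ count-plug i C (corolla ℓ d) ⟩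
  count i (ctxLabels C) + count i (labels (corolla ℓ d)) ≡⟨ cong (λ z → count i (ctxLabels C) + count i z) (labels-corolla ℓ d) ⟩
  count i (ctxLabels C) + count i (ℓ ∷ [])      ≡⟨ cong (_+ count i (ℓ ∷ [])) (sym (trans (count-plug i C leaf) (+-identityʳ _))) ⟩
  count i (labels (plug C leaf)) + count i (ℓ ∷ []) ∎
  where open ≡-Reasoning

leaves-corolla-plug : ∀ C ℓ d → leaves (plug C (corolla ℓ d)) ≡ leavesBefore C + (d + leavesAfter C)
leaves-corolla-plug C ℓ d = trans (leaves-plug C (corolla ℓ d)) (cong (λ z → leavesBefore C + (z + leavesAfter C)) (leaves-corolla ℓ d))

leaves-corolla-plug-suc : ∀ C ℓ d → leaves (plug C (corolla ℓ (suc d))) ≡ suc (leaves (plug C (corolla ℓ d)))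
leaves-corolla-plug-suc C ℓ d =
  trans (leaves-corolla-plug C ℓ (suc d)) (trans (+-suc _ _) (cong suc (sym (leaves-corolla-plug C ℓ d))))

leaves-corolla2-plug : ∀ C ℓ → leaves (plug C (corolla ℓ 2)) ≡ suc (leaves (plug C leaf))
leaves-corolla2-plug C ℓ =
  trans (leaves-corolla-plug C ℓ 2) (trans (+-suc _ _) (cong suc (sym (leaves-plug C leaf))))

count-subtree-≤ : ∀ m C x → count m (labels x) ≤ count m (labels (plug C x))
count-subtree-≤ m C x = subst (count m (labels x) ≤_) (sym (count-plug m C x)) (m≤n+m _ _)

max-label-unique : ∀ C ℓ us → Valid (plug C (node ℓ us)) → ℓ ≡ internal (plug C (node ℓ us)) →
                   count ℓ (ctxLabels C) ≡ 0
max-label-unique C ℓ us v ℓ≡max = m+n≡0⇒m≡0 _ (suc-injective (trans (sym (+-suc _ _)) occurs))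
  where
  1≤ℓ : 1 ≤ ℓ
  1≤ℓ = proj₁ (valid-bounded v ℓ (count-label-plug C ℓ us))
  occurs : count ℓ (ctxLabels C) + suc (count ℓ (labelsF us)) ≡ 1
  occurs = trans (cong (count ℓ (ctxLabels C) +_) (sym (count-here ℓ (labelsF us))))
               (trans (sym (count-plug ℓ C (node ℓ us))) (exact v ℓ 1≤ℓ (≤-reflexive ℓ≡max)))

children-leaves : ∀ ℓ us → T (isIncreasingF ℓ us) → (∀ m → 1 ≤ count m (labelsF us) → m ≤ ℓ) →
                  us ≡ replicate (length us) leaf
children-leaves ℓ []              inc below = refl
children-leaves ℓ (leaf ∷ us)     inc below = cong (leaf ∷_) (children-leaves ℓ us inc below)
children-leaves ℓ (node m vs ∷ us) inc below = ⊥-elim (<⇒≱ (<ᵇ⇒< ℓ m (∧-fst {ℓ <ᵇ m} inc))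
  (below m (≤-trans (subst (1 ≤_) (sym (count-here m (labelsF vs))) (s≤s z≤n)) (count-++ˡ m (labels (node m vs)) (labelsF us)))))

record MaxCorolla (t : Tree) : Set where
  field
    ctx      : Ctx
    degree   : ℕ
    found    : findLabel (internal t) t ≡ just (ctx , replicate degree leaf)
    shape    : t ≡ plug ctx (corolla (internal t) degree)
    unique   : count (internal t) (ctxLabels ctx) ≡ 0
    degree≥2 : 2 ≤ degree

maxCorolla : ∀ t → Valid t → 1 ≤ internal t → MaxCorolla t
maxCorolla t v 1≤ℓ with findLabel (internal t) t in search
... | nothing = ⊥-elim (0≢1+n (trans (sym (findLabel-complete (internal t) t search)) (exact v (internal t) 1≤ℓ ≤-refl)))
... | just (C , us) = record
  { ctx = C ; degree = length us
  ; found = trans search (cong (λ z → just (C , z)) allLeaves)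
  ; shape = shape
  ; unique = max-label-unique C ℓ us v₀ (cong internal shape₀)
  ; degree≥2 = isSchroder-corolla⁻ ℓ (length us) (subst (λ z → T (isSchroder z)) shape-sub (schroder-subtree C (node ℓ us) (schroder v₀)))
  }
  where
  ℓ = internal t
  shape₀ : t ≡ plug C (node ℓ us)
  shape₀ = findLabel-sound ℓ t C us search
  v₀ : Valid (plug C (node ℓ us))
  v₀ = subst Valid shape₀ v
  below : ∀ m → 1 ≤ count m (labelsF us) → m ≤ ℓ
  below m pos = subst (m ≤_) (sym (cong internal shape₀)) (proj₂ (valid-bounded v₀ m
    (≤-trans pos (≤-trans (count-++ʳ m (ℓ ∷ []) (labelsF us)) (count-subtree-≤ m C (node ℓ us))))))
  allLeaves : us ≡ replicate (length us) leaf
  allLeaves = children-leaves ℓ us (increasing-subtree C (node ℓ us) (increasing v₀)) below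
  shape-sub : node ℓ us ≡ corolla ℓ (length us)
  shape-sub = cong (node ℓ) allLeaves
  shape : t ≡ plug C (corolla ℓ (length us))
  shape = trans shape₀ (cong (plug C) shape-sub)

labels-resize : ∀ C ℓ d d′ → labels (plug C (corolla ℓ d′)) ≡ labels (plug C (corolla ℓ d))
labels-resize C ℓ d d′ =
  trans (labels-plug C (corolla ℓ d′))
        (trans (cong (λ z → labelsBefore C ++ z ++ labelsAfter C) (trans (labels-corolla ℓ d′) (sym (labels-corolla ℓ d))))
               (sym (labels-plug C (corolla ℓ d))))

internal-resize : ∀ C ℓ d d′ → internal (plug C (corolla ℓ d′)) ≡ internal (plug C (corolla ℓ d))
internal-resize C ℓ d d′ = cong length (labels-resize C ℓ d d′)

valid-resize : ∀ C ℓ d d′ → 2 ≤ d′ → Valid (plug C (corolla ℓ d)) → Valid (plug C (corolla ℓ d′))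
valid-resize C ℓ d d′ 2≤d′ v = valid
  (schroder-replace C _ _ (schroder v) (isSchroder-corolla ℓ d′ 2≤d′))
  (increasing-replace C _ _ (increasing v) (isIncreasing-corolla ℓ d′)
     (subst T (fitsHole-root C ℓ _ _) (increasing-fits C _ (increasing v))))
  (subst Exact (sym (labels-resize C ℓ d d′)) (exact v))

valid-prune : ∀ C ℓ d → Valid (plug C (corolla ℓ d)) → ℓ ≡ internal (plug C (corolla ℓ d)) → Valid (plug C leaf)
valid-prune C ℓ d v ℓ≡max = valid
  (schroder-replace C _ leaf (schroder v) tt)
  (increasing-replace C _ leaf (increasing v) tt (fitsHole-leaf C))
  exactRest
  where
  exactRest : Exact (labels (plug C leaf))
  exactRest i 1≤i i≤ = begin
    count i (labels (plug C leaf))                    ≡⟨ sym (+-identityʳ _) ⟩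
    count i (labels (plug C leaf)) + 0                ≡⟨ cong (count i (labels (plug C leaf)) +_) (sym (count-there i ℓ [] i≢ℓ)) ⟩
    count i (labels (plug C leaf)) + count i (ℓ ∷ []) ≡⟨ sym (count-corolla-plug i C ℓ d) ⟩
    count i (labels (plug C (corolla ℓ d)))           ≡⟨ exact v i 1≤i (≤-trans i≤ (≤-trans (n≤1+n _) internal≤)) ⟩
    1 ∎
    where
    open ≡-Reasoning
    internal≤ : suc (internal (plug C leaf)) ≤ internal (plug C (corolla ℓ d))
    internal≤ = ≤-reflexive (sym (internal-corolla-plug C ℓ d))
    i≢ℓ : i ≢ ℓ
    i≢ℓ i≡ℓ = <-irrefl (trans i≡ℓ (trans ℓ≡max (internal-corolla-plug C ℓ d))) (s≤s i≤)

valid-graft : ∀ C → Valid (plug C leaf) → Valid (plug C (corolla (suc (internal (plug C leaf))) 2))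
valid-graft C v = valid
  (schroder-replace C leaf _ (schroder v) (isSchroder-corolla m 2 (s≤s (s≤s z≤n))))
  (increasing-replace C leaf _ (increasing v) tt (fitsHole-above C m _ (λ l pos → s≤s (proj₂ (valid-bounded v l (inTree l pos))))))
  exactNew
  where
  t₀ = plug C leaf
  m = suc (internal t₀)
  inTree : ∀ l → 1 ≤ count l (labelsBefore C) → 1 ≤ count l (labels t₀)
  inTree l pos = subst (1 ≤_) (sym (trans (count-plug l C leaf) (+-identityʳ _))) (≤-trans pos (count-++ˡ l (labelsBefore C) (labelsAfter C)))
  exactNew : Exact (labels (plug C (corolla m 2)))
  exactNew i 1≤i i≤ with i ≟ m
  ... | yes refl = trans (count-corolla-plug i C i 2) (cong₂ _+_ absent (count-here i []))
    where
    absent : count i (labels t₀) ≡ 0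
    absent with count i (labels t₀) in occ
    ... | zero  = refl
    ... | suc _ = ⊥-elim (<-irrefl refl (s≤s (proj₂ (valid-bounded v i (subst (1 ≤_) (sym occ) (s≤s z≤n))))))
  ... | no i≢m = trans (count-corolla-plug i C m 2) (trans (cong₂ _+_ (exact v i 1≤i i≤old) (count-there i m [] i≢m)) (+-identityʳ 1))
    where
    i≤old : i ≤ internal t₀
    i≤old with m≤n⇒m<n∨m≡n (subst (i ≤_) (internal-corolla-plug C m 2) i≤)
    ... | inj₁ i<m = s≤s⁻¹ i<m
    ... | inj₂ i≡m = ⊥-elim (i≢m i≡m)

empty↔Fin0 : ∀ {A : Set} → (A → ⊥) → A ↔ Fin 0
empty↔Fin0 ¬a = mk↔ₛ′ (λ a → ⊥-elim (¬a a)) (λ ()) (λ ()) (λ a → ⊥-elim (¬a a))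

-- Reading the construction
-- backwards from a tree with L leaves: if the tree is the corolla with k leaves it is the
-- base case (L ≡ k); otherwise its maximal corolla either has two leaves and is pruned to a
-- leaf, remembering the position of that leaf among the L-1 leaves of the smaller tree
-- (Fin (L-1) × Code (L-1)), or has more leaves and loses one (Code⁺ (L-1)), the smaller
-- tree still having at least two internal nodes.
module Codes (k : ℕ) where

  mutual
    -- codes of trees with at least two internal nodes
    Code⁺ : ℕ → Set
    Code⁺ zero    = ⊥
    Code⁺ (suc L) = (Fin L × Code L) ⊎ Code⁺ L

    Code : ℕ → Set
    Code L = (L ≡ k) ⊎ Code⁺ L

  isBase : ℕ → ℕ
  isBase L with L ≟ k
  ... | yes _ = 1
  ... | no  _ = 0

  mutual
    codes⁺ : ℕ → ℕ
    codes⁺ zero    = 0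
    codes⁺ (suc L) = L * codes L + codes⁺ L

    codes : ℕ → ℕ
    codes L = isBase L + codes⁺ L

  base↔Fin : ∀ L → (L ≡ k) ↔ Fin (isBase L)
  base↔Fin L with L ≟ k
  ... | yes L≡k = mk↔ₛ′ (λ _ → Fin.zero) (λ _ → L≡k) (λ { Fin.zero → refl ; (Fin.suc ()) }) (λ _ → ≡-irrelevant _ _)
  ... | no  L≢k = empty↔Fin0 L≢k

  mutual
    Code⁺↔Fin : ∀ L → Code⁺ L ↔ Fin (codes⁺ L)
    Code⁺↔Fin zero    = empty↔Fin0 (λ ())
    Code⁺↔Fin (suc L) = ↔-trans ((↔-trans (↔-refl ×-↔ Code↔Fin L) (↔-sym *↔×)) ⊎-↔ Code⁺↔Fin L) (↔-sym +↔⊎)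

    Code↔Fin : ∀ L → Code L ↔ Fin (codes L)
    Code↔Fin L = ↔-trans (base↔Fin L ⊎-↔ Code⁺↔Fin L) (↔-sym +↔⊎)

  isBase-k : isBase k ≡ 1
  isBase-k with k ≟ k
  ... | yes _   = refl
  ... | no  k≢k = ⊥-elim (k≢k refl)

  isBase-other : ∀ L → L ≢ k → isBase L ≡ 0
  isBase-other L L≢k with L ≟ k
  ... | yes L≡k = ⊥-elim (L≢k L≡k)
  ... | no  _   = refl

  codes⁺-small : ∀ L → L ≤ k → codes⁺ L ≡ 0
  codes⁺-small zero    _   = refl
  codes⁺-small (suc L) L<k = begin
    L * (isBase L + codes⁺ L) + codes⁺ L
      ≡⟨ cong₂ (λ a b → L * (a + b) + b) (isBase-other L (<⇒≢ L<k)) (codes⁺-small L (<⇒≤ L<k)) ⟩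
    L * 0 + 0
      ≡⟨ cong (_+ 0) (*-zeroʳ L) ⟩
    0 ∎
    where open ≡-Reasoning

  codes-k : codes k ≡ 1
  codes-k = cong₂ _+_ isBase-k (codes⁺-small k ≤-refl)

  codes-above : ∀ L → k < L → codes L ≡ codes⁺ L
  codes-above L k<L = cong (_+ codes⁺ L) (isBase-other L (λ L≡k → <-irrefl (sym L≡k) k<L))

  -- With k+1 leaves: a graft onto one of the k leaves of the base corolla.
  codes-suc-k : codes (suc k) ≡ k
  codes-suc-k = begin
    codes (suc k)            ≡⟨ codes-above (suc k) ≤-refl ⟩
    k * codes k + codes⁺ k   ≡⟨ cong₂ (λ a b → k * a + b) codes-k (codes⁺-small k ≤-refl) ⟩
    k * 1 + 0                ≡⟨ trans (+-identityʳ _) (*-identityʳ k) ⟩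
    k ∎
    where open ≡-Reasoning

  -- Above k, every tree is either grafted at one of L leaves or enlarged: factor L+1.
  codes-step : ∀ L → k < L → codes (suc L) ≡ suc L * codes L
  codes-step L k<L = begin
    codes (suc L)           ≡⟨ codes-above (suc L) (m<n⇒m<1+n k<L) ⟩
    L * codes L + codes⁺ L  ≡⟨ cong (L * codes L +_) (sym (codes-above L k<L)) ⟩
    L * codes L + codes L   ≡⟨ +-comm (L * codes L) (codes L) ⟩
    suc L * codes L ∎
    where open ≡-Reasoning

  codes-closed : ∀ L → k < L → codes L * (suc k) ! ≡ k * L !
  codes-closed (suc L) (s≤s k≤L) with m≤n⇒m<n∨m≡n k≤L
  ... | inj₂ refl = cong (_* (suc k) !) codes-suc-k
  ... | inj₁ k<L  = begin
    codes (suc L) * (suc k) !       ≡⟨ cong (_* (suc k) !) (codes-step L k<L) ⟩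
    suc L * codes L * (suc k) !     ≡⟨ *-assoc (suc L) (codes L) _ ⟩
    suc L * (codes L * (suc k) !)   ≡⟨ cong (suc L *_) (codes-closed L k<L) ⟩
    suc L * (k * L !)               ≡⟨ solve 3 (λ a b c → a :* (b :* c) := b :* (a :* c)) refl (suc L) k (L !) ⟩
    k * (suc L * L !) ∎
    where open ≡-Reasoning

mutual
  leaves-positive : ∀ t → T (isSchroder t) → 1 ≤ leaves t
  leaves-positive leaf        _  = s≤s z≤n
  leaves-positive (node l ts) ok =
    ≤-trans (≤-trans (s≤s z≤n) (≤ᵇ⇒≤ 2 (length ts) (∧-fst {2 ≤ᵇ length ts} ok))) (length≤leavesF ts (∧-snd {2 ≤ᵇ length ts} ok))

  length≤leavesF : ∀ ts → T (isSchroderF ts) → length ts ≤ leavesF ts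
  length≤leavesF []       _  = z≤n
  length≤leavesF (t ∷ ts) ok = +-mono-≤ (leaves-positive t (∧-fst {isSchroder t} ok)) (length≤leavesF ts (∧-snd {isSchroder t} ok))

rootDegree≤leaves : ∀ t → T (isSchroder t) → rootDegree t ≤ leaves t
rootDegree≤leaves leaf        _  = z≤n
rootDegree≤leaves (node l ts) ok = length≤leavesF ts (∧-snd {2 ≤ᵇ length ts} ok)

-- The hole is below the root when the root is not the hole itself: when a leaf there
-- would give positive root degree, or a corolla there leaves a second internal node.
rootDegree-replace-leaf : ∀ C y → 1 ≤ rootDegree (plug C leaf) → rootDegree (plug C y) ≡ rootDegree (plug C leaf)
rootDegree-replace-leaf (frame l ls rs ∷ C) y _ = trans (length-++ ls) (sym (length-++ ls))

rootDegree-replace-corolla : ∀ C ℓ d y → 2 ≤ internal (plug C (corolla ℓ d)) →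
                             rootDegree (plug C y) ≡ rootDegree (plug C (corolla ℓ d))
rootDegree-replace-corolla []                  ℓ d y big = ⊥-elim (<⇒≱ big (≤-reflexive (cong length (labels-corolla ℓ d))))
rootDegree-replace-corolla (frame l ls rs ∷ C) ℓ d y _   = trans (length-++ ls) (sym (length-++ ls))

internal-below-root : ∀ f C x → 1 ≤ internal x → 2 ≤ internal (plug (f ∷ C) x)
internal-below-root (frame l ls rs) C x pos =
  subst (2 ≤_) (sym (length-labels-plug (frame l ls rs ∷ C) x)) (+-mono-≤ (s≤s z≤n) pos)

graft : ℕ → Tree → Tree
graft p t = plug (locateLeaf p t) (corolla (suc (internal t)) 2)

addLeaf : Found → ℕ → Tree
addLeaf (just (C , us)) ℓ = plug C (node ℓ (leaf ∷ us))
addLeaf nothing         ℓ = leaf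

enlarge : Tree → Tree
enlarge t = addLeaf (findLabel (internal t) t) (internal t)

graft-plug : ∀ C → graft (leavesBefore C) (plug C leaf) ≡ plug C (corolla (suc (internal (plug C leaf))) 2)
graft-plug C = cong (λ C′ → plug C′ (corolla (suc (internal (plug C leaf))) 2)) (locateLeaf-plug C)

enlarge-plug : ∀ C ℓ d → count ℓ (ctxLabels C) ≡ 0 → internal (plug C (corolla ℓ d)) ≡ ℓ →
               enlarge (plug C (corolla ℓ d)) ≡ plug C (corolla ℓ (suc d))
enlarge-plug C ℓ d unique max rewrite max = cong (λ found → addLeaf found ℓ) (findLabel-plug ℓ C (replicate d leaf) unique)

maxCorolla-unique : ∀ {t} → Valid t → (mc : MaxCorolla t) → ∀ C d → t ≡ plug C (corolla (internal t) d) →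
                    MaxCorolla.ctx mc ≡ C × MaxCorolla.degree mc ≡ d
maxCorolla-unique {t} v mc C d shape =
  cong proj₁ same , trans (sym (length-replicate (MaxCorolla.degree mc))) (trans (cong (λ z → length (proj₂ z)) same) (length-replicate d))
  where
  ℓ = internal t
  unique : count ℓ (ctxLabels C) ≡ 0
  unique = max-label-unique C ℓ _ (subst Valid shape v) (cong internal shape)
  same : (MaxCorolla.ctx mc , replicate (MaxCorolla.degree mc) leaf) ≡ (C , replicate d leaf)
  same = just-injective (trans (sym (MaxCorolla.found mc))
                               (trans (cong (findLabel ℓ) shape) (findLabel-plug ℓ C (replicate d leaf) unique)))

module Bijection (k : ℕ) (2≤k : 2 ≤ k) where

  open Codes k

  record Member (L : ℕ) (t : Tree) : Set where
    constructor member
    field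
      isValid   : Valid t
      hasLeaves : leaves t ≡ L
      hasDegree : rootDegree t ≡ k
  open Member

  member-leaves≥k : ∀ {L t} → Member L t → k ≤ L
  member-leaves≥k {L} {t} m =
    subst₂ _≤_ (hasDegree m) (hasLeaves m) (rootDegree≤leaves t (schroder (isValid m)))

  member-internal≥1 : ∀ {L t} → Member L t → 1 ≤ internal t
  member-internal≥1 {t = leaf}      m = ⊥-elim (<⇒≱ 2≤k (≤-trans (≤-reflexive (sym (hasDegree m))) z≤n))
  member-internal≥1 {t = node l ts} m = s≤s z≤n

  base : Tree
  base = corolla 1 k

  internal-base : internal base ≡ 1
  internal-base = cong length (labels-corolla 1 k)

  base-member : Member k base
  base-member = member
    (valid (isSchroder-corolla 1 k 2≤k) (isIncreasing-corolla 1 k) (subst Exact (sym (labels-corolla 1 k)) exact-1))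
    (leaves-corolla 1 k) (rootDegree-corolla 1 k)
    where
    exact-1 : Exact (1 ∷ [])
    exact-1 (suc zero)    _ _        = refl
    exact-1 (suc (suc i)) _ (s≤s ())

  base-only : ∀ {L t} → Member L t → internal t ≤ 1 → L ≡ k × t ≡ base
  base-only {L} {t} m small with maxCorolla t (isValid m) (member-internal≥1 m)
  ... | record { ctx = C ; degree = d ; shape = shape } = atRoot C shape
    where
    one : internal t ≡ 1
    one = ≤-antisym small (member-internal≥1 m)
    atRoot : ∀ C → t ≡ plug C (corolla (internal t) d) → L ≡ k × t ≡ base
    atRoot [] shape = trans (sym (hasLeaves m)) (trans (cong leaves shape) (trans (leaves-corolla (internal t) d) d≡k)) ,
                      trans shape (cong₂ corolla one d≡k)
      where
      d≡k : d ≡ k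
      d≡k = trans (sym (rootDegree-corolla (internal t) d)) (trans (cong rootDegree (sym shape)) (hasDegree m))
    atRoot (f ∷ C) shape = ⊥-elim (<⇒≱ (subst (2 ≤_) (cong internal (sym shape))
      (internal-below-root f C _ (≤-reflexive (sym (cong length (labels-corolla (internal t) d))))))
      (≤-reflexive one))

  graft-plug-member : ∀ {L} C → Member L (plug C leaf) →
                      let t′ = plug C (corolla (suc (internal (plug C leaf))) 2)
                      in Member (suc L) t′ × internal t′ ≡ suc (internal (plug C leaf))
  graft-plug-member C m =
    member (valid-graft C (isValid m))
           (trans (leaves-corolla2-plug C _) (cong suc (hasLeaves m)))
           (trans (rootDegree-replace-leaf C _ (subst (1 ≤_) (sym (hasDegree m)) (≤-trans (s≤s z≤n) 2≤k))) (hasDegree m)) ,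
    internal-corolla-plug C _ 2

  graft-member : ∀ {L t} p → Member L t → p < L → Member (suc L) (graft p t) × internal (graft p t) ≡ suc (internal t)
  graft-member {L} {t} p m p<L =
    subst Grown plugged (graft-plug-member C (subst (Member L) (sym plugged) m))
    where
    C = locateLeaf p t
    plugged : plug C leaf ≡ t
    plugged = proj₁ (locateLeaf-spec p t (subst (p <_) (sym (hasLeaves m)) p<L))
    Grown : Tree → Set
    Grown t′ = let t″ = plug C (corolla (suc (internal t′)) 2) in Member (suc L) t″ × internal t″ ≡ suc (internal t′)

  prune-member : ∀ {L t} C → Member (suc L) t → 2 ≤ internal t → t ≡ plug C (corolla (internal t) 2) → Member L (plug C leaf)
  prune-member {L} {t} C m big shape = member
    (valid-prune C _ 2 (subst Valid shape (isValid m)) (cong internal shape))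
    (suc-injective (trans (sym (leaves-corolla2-plug C (internal t))) (trans (cong leaves (sym shape)) (hasLeaves m))))
    (trans (rootDegree-replace-corolla C _ 2 leaf (subst (λ z → 2 ≤ internal z) shape big)) (trans (cong rootDegree (sym shape)) (hasDegree m)))

  resize-member : ∀ {L L′} C ℓ d d′ → 2 ≤ d′ → 2 ≤ internal (plug C (corolla ℓ d)) → Member L (plug C (corolla ℓ d)) →
                  leaves (plug C (corolla ℓ d′)) ≡ L′ → Member L′ (plug C (corolla ℓ d′))
  resize-member C ℓ d d′ 2≤d′ big m size = member
    (valid-resize C ℓ d d′ 2≤d′ (isValid m)) size
    (trans (rootDegree-replace-corolla C ℓ d _ big) (hasDegree m))

  mutual
    decode : ∀ {L} → Code L → Tree
    decode (inj₁ _) = base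
    decode (inj₂ c) = decode⁺ c

    decode⁺ : ∀ {L} → Code⁺ L → Tree
    decode⁺ {suc L} (inj₁ (p , c)) = graft (toℕ p) (decode c)
    decode⁺ {suc L} (inj₂ c)       = enlarge (decode⁺ c)

  maxOf : ∀ {L t} → Member L t → 2 ≤ internal t → MaxCorolla t
  maxOf {t = t} m big = maxCorolla t (isValid m) (≤-trans (s≤s z≤n) big)

  enlarge-shape : ∀ {t} (mc : MaxCorolla t) →
                  enlarge t ≡ plug (MaxCorolla.ctx mc) (corolla (internal t) (suc (MaxCorolla.degree mc)))
  enlarge-shape {t} mc = trans (cong enlarge (MaxCorolla.shape mc))
    (enlarge-plug (MaxCorolla.ctx mc) (internal t) _ (MaxCorolla.unique mc) (sym (cong internal (MaxCorolla.shape mc))))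

  enlarge-member : ∀ {L t} → Member L t → 2 ≤ internal t → Member (suc L) (enlarge t) × internal (enlarge t) ≡ internal t
  enlarge-member {L} {t} m big =
    subst (λ t′ → Member (suc L) t′ × internal t′ ≡ internal t) (sym (enlarge-shape mc))
      ( resize-member C ℓ d (suc d) (≤-trans (MaxCorolla.degree≥2 mc) (n≤1+n d))
          (subst (λ z → 2 ≤ internal z) shape big) (subst (Member L) shape m)
          (trans (leaves-corolla-plug-suc C ℓ d) (cong suc (trans (cong leaves (sym shape)) (hasLeaves m))))
      , trans (internal-resize C ℓ d (suc d)) (cong internal (sym shape)))
    where
    mc = maxOf m big
    ℓ = internal t
    C = MaxCorolla.ctx mc
    d = MaxCorolla.degree mc
    shape = MaxCorolla.shape mc

  mutual
    decode-member : ∀ {L} (c : Code L) → Member L (decode c) × 1 ≤ internal (decode c)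
    decode-member (inj₁ refl) = base-member , ≤-reflexive (sym internal-base)
    decode-member (inj₂ c)    = proj₁ (decode⁺-member c) , ≤-trans (s≤s z≤n) (proj₂ (decode⁺-member c))

    decode⁺-member : ∀ {L} (c : Code⁺ L) → Member L (decode⁺ c) × 2 ≤ internal (decode⁺ c)
    decode⁺-member {suc L} (inj₁ (p , c)) with graft-member (toℕ p) (proj₁ (decode-member c)) (toℕ<n p)
    ... | m , grown = m , subst (2 ≤_) (sym grown) (s≤s (proj₂ (decode-member c)))
    decode⁺-member {suc L} (inj₂ c) with enlarge-member (proj₁ (decode⁺-member c)) (proj₂ (decode⁺-member c))
    ... | m , same = m , subst (2 ≤_) (sym same) (proj₂ (decode⁺-member c))

  position< : ∀ {L t} C → Member (suc L) t → 2 ≤ internal t → t ≡ plug C (corolla (internal t) 2) → leavesBefore C < L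
  position< C m big shape = subst (leavesBefore C <_) (hasLeaves (prune-member C m big shape)) (leavesBefore<leaves C)

  shrink-member : ∀ {L t} C d → Member (suc L) t → 2 ≤ internal t → t ≡ plug C (corolla (internal t) (suc (suc (suc d)))) →
                  Member L (plug C (corolla (internal t) (suc (suc d))))
  shrink-member {L} {t} C d m big shape =
    resize-member C (internal t) (3 + d) (2 + d) (s≤s (s≤s z≤n)) (subst (λ z → 2 ≤ internal z) shape big) (subst (Member (suc L)) shape m)
      (suc-injective (trans (sym (leaves-corolla-plug-suc C (internal t) (2 + d))) (trans (cong leaves (sym shape)) (hasLeaves m))))

  shrunk-big : ∀ {t} C d → 2 ≤ internal t → t ≡ plug C (corolla (internal t) (suc (suc (suc d)))) →
               2 ≤ internal (plug C (corolla (internal t) (suc (suc d))))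
  shrunk-big {t} C d big shape =
    subst (2 ≤_) (sym (trans (internal-resize C (internal t) (3 + d) (2 + d)) (cong internal (sym shape)))) big

  mutual
    encode : ∀ L t → Member L t → Code L
    encode L t m with 2 ≤? internal t
    ... | no  small = inj₁ (proj₁ (base-only m (s≤s⁻¹ (≰⇒> small))))
    ... | yes big   = inj₂ (encode⁺ L t m big)

    encode⁺ : ∀ L t → Member L t → 2 ≤ internal t → Code⁺ L
    encode⁺ L t m big = encodeAt L t m big (MaxCorolla.ctx mc) (MaxCorolla.degree mc) (MaxCorolla.degree≥2 mc) (MaxCorolla.shape mc)
      where mc = maxOf m big

    encodeAt : ∀ L t → Member L t → 2 ≤ internal t → ∀ C d → 2 ≤ d → t ≡ plug C (corolla (internal t) d) → Code⁺ L
    encodeAt zero t m big C d 2≤d shape = ⊥-elim (<⇒≱ 2≤k (≤-trans (member-leaves≥k m) z≤n))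
    encodeAt (suc L) t m big C 1 (s≤s ()) shape
    encodeAt (suc L) t m big C 2 2≤d shape =
      inj₁ (fromℕ< (position< C m big shape) , encode L (plug C leaf) (prune-member C m big shape))
    encodeAt (suc L) t m big C (suc (suc (suc d))) 2≤d shape =
      inj₂ (encode⁺ L (plug C (corolla (internal t) (suc (suc d)))) (shrink-member C d m big shape) (shrunk-big C d big shape))


  mutual
    decode-encode : ∀ L t (m : Member L t) → decode (encode L t m) ≡ t
    decode-encode L t m with 2 ≤? internal t
    ... | no  small = sym (proj₂ (base-only m (s≤s⁻¹ (≰⇒> small))))
    ... | yes big   = decode⁺-encode⁺ L t m big

    decode⁺-encode⁺ : ∀ L t (m : Member L t) big → decode⁺ (encode⁺ L t m big) ≡ t
    decode⁺-encode⁺ L t m big = decode-encodeAt L t m big _ _ _ _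

    decode-encodeAt : ∀ L t (m : Member L t) big C d 2≤d shape → decode⁺ (encodeAt L t m big C d 2≤d shape) ≡ t
    decode-encodeAt zero    t m big C d 2≤d shape = ⊥-elim (<⇒≱ 2≤k (≤-trans (member-leaves≥k m) z≤n))
    decode-encodeAt (suc L) t m big C 1 (s≤s ()) shape
    decode-encodeAt (suc L) t m big C 2 2≤d shape = begin
      graft (toℕ (fromℕ< (position< C m big shape))) (decode (encode L (plug C leaf) m′))
        ≡⟨ cong₂ graft (toℕ-fromℕ< (position< C m big shape)) (decode-encode L (plug C leaf) m′) ⟩
      graft (leavesBefore C) (plug C leaf)
        ≡⟨ graft-plug C ⟩
      plug C (corolla (suc (internal (plug C leaf))) 2)
        ≡⟨ cong (λ n → plug C (corolla n 2)) (sym (trans (cong internal shape) (internal-corolla-plug C _ 2))) ⟩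
      plug C (corolla (internal t) 2)
        ≡⟨ sym shape ⟩
      t ∎
      where
      open ≡-Reasoning
      m′ = prune-member C m big shape
    decode-encodeAt (suc L) t m big C (suc (suc (suc d))) 2≤d shape = begin
      enlarge (decode⁺ (encode⁺ L t′ m′ big′))
        ≡⟨ cong enlarge (decode⁺-encode⁺ L t′ m′ big′) ⟩
      enlarge t′
        ≡⟨ enlarge-plug C ℓ (2 + d) unique (trans (internal-resize C ℓ (3 + d) (2 + d)) (cong internal (sym shape))) ⟩
      plug C (corolla ℓ (3 + d))
        ≡⟨ sym shape ⟩
      t ∎
      where
      open ≡-Reasoning
      ℓ = internal t
      t′ = plug C (corolla ℓ (2 + d))
      m′ = shrink-member C d m big shape
      big′ = shrunk-big C d big shape
      unique : count ℓ (ctxLabels C) ≡ 0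
      unique = max-label-unique C ℓ _ (subst Valid shape (isValid m)) (cong internal shape)

  encode⁺-at : ∀ L t (m : Member L t) big C d 2≤d shape → encode⁺ L t m big ≡ encodeAt L t m big C d 2≤d shape
  encode⁺-at L t m big C d 2≤d shape with maxCorolla-unique (isValid m) (maxOf m big) C d shape
  ... | refl , refl = cong₂ (encodeAt L t m big _ _) (≤-irrelevant _ _) (uip _ _)

  mutual
    encode-decode : ∀ {L} (c : Code L) t → t ≡ decode c → (m : Member L t) → encode L t m ≡ c
    encode-decode (inj₁ refl) t refl m with 2 ≤? internal base
    ... | no  _   = cong inj₁ (≡-irrelevant _ _)
    ... | yes big = ⊥-elim (<⇒≱ big (≤-reflexive internal-base))
    encode-decode (inj₂ c) t refl m with 2 ≤? internal (decode⁺ c)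
    ... | no  small = ⊥-elim (small (proj₂ (decode⁺-member c)))
    ... | yes big   = cong inj₂ (encode⁺-decode⁺ c _ refl m big)

    encode⁺-decode⁺ : ∀ {L} (c : Code⁺ L) t → t ≡ decode⁺ c → (m : Member L t) (big : 2 ≤ internal t) → encode⁺ L t m big ≡ c
    encode⁺-decode⁺ {suc L} (inj₁ (p , c)) t refl m big =
      trans (encode⁺-at (suc L) t m big C 2 (s≤s (s≤s z≤n)) shape)
            (cong₂ (λ q c′ → inj₁ (q , c′))
                   (trans (fromℕ<-cong _ _ before (position< C m big shape) (toℕ<n p)) (fromℕ<-toℕ p (toℕ<n p)))
                   (encode-decode c (plug C leaf) plugged (prune-member C m big shape)))
      where
      t₀ = decode c
      C = locateLeaf (toℕ p) t₀
      spec = locateLeaf-spec (toℕ p) t₀ (subst (toℕ p <_) (sym (hasLeaves (proj₁ (decode-member c)))) (toℕ<n p))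
      plugged = proj₁ spec
      before = proj₂ spec
      shape : t ≡ plug C (corolla (internal t) 2)
      shape = cong (λ n → plug C (corolla n 2))
                (sym (trans (internal-corolla-plug C _ 2) (cong (λ z → suc (internal z)) plugged)))
    encode⁺-decode⁺ {suc L} (inj₂ c) t refl m big =
      enlarged (MaxCorolla.degree mc) (MaxCorolla.degree≥2 mc) (MaxCorolla.shape mc)
               (trans (enlarge-shape mc) (cong (λ n → plug C (corolla n (suc (MaxCorolla.degree mc)))) (sym same)))
      where
      t₀ = decode⁺ c
      m₀ = proj₁ (decode⁺-member c)
      big₀ = proj₂ (decode⁺-member c)
      mc = maxOf m₀ big₀
      C = MaxCorolla.ctx mc
      same : internal t ≡ internal t₀
      same = proj₂ (enlarge-member m₀ big₀)
      enlarged : ∀ d → 2 ≤ d → t₀ ≡ plug C (corolla (internal t₀) d) → t ≡ plug C (corolla (internal t) (suc d)) →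
                 encode⁺ (suc L) t m big ≡ inj₂ c
      enlarged 1 (s≤s ()) shape₀ shape
      enlarged (suc (suc d)) _ shape₀ shape =
        trans (encode⁺-at (suc L) t m big C (3 + d) (s≤s (s≤s z≤n)) shape)
              (cong inj₂ (encode⁺-decode⁺ c _ shrunk _ _))
        where
        shrunk : plug C (corolla (internal t) (2 + d)) ≡ t₀
        shrunk = trans (cong (λ n → plug C (corolla n (2 + d))) same) (sym shape₀)

  -- Trees with any two equal underlying trees are equal: the side conditions are propositions.
  SISTdeg-≡ : ∀ {n} {t t′ : Tree} → t ≡ t′ → ∀ ok ok′ (size : leaves t ≡ n) size′ (deg : rootDegree t ≡ k) deg′ →
              _≡_ {A = SISTdeg n k} (t , ok , size , deg) (t′ , ok′ , size′ , deg′)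
  SISTdeg-≡ refl ok ok′ size size′ deg deg′ =
    cong₂ (λ o p → _ , o , p) (T-irrelevant ok ok′) (cong₂ _,_ (≡-irrelevant size size′) (≡-irrelevant deg deg′))

  SISTdeg↔Code : ∀ n → SISTdeg n k ↔ Code n
  SISTdeg↔Code n = mk↔ₛ′ to from (λ c → encode-decode c (decode c) refl _)
    (λ { (t , ok , size , deg) → SISTdeg-≡ (decode-encode n t (member (toValid ok) size deg)) _ ok _ size _ deg })
    where
    to : SISTdeg n k → Code n
    to (t , ok , size , deg) = encode n t (member (toValid ok) size deg)
    from : Code n → SISTdeg n k
    from c = decode c , fromValid (isValid m) , hasLeaves m , hasDegree m
      where m = proj₁ (decode-member c)

degreeCount : ℕ → ℕ → ℕ
degreeCount n zero          = 0
degreeCount n (suc zero)    = 0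
degreeCount n (suc (suc j)) = Codes.codes (suc (suc j)) n

-- No tree with n ≥ 2 leaves has root degree 0 (it would be a leaf) or 1 (not Schröder).
SISTdeg↔Fin : ∀ n → 2 ≤ n → ∀ d → SISTdeg n d ↔ Fin (degreeCount n d)
SISTdeg↔Fin n 2≤n zero          = empty↔Fin0 λ { (leaf , _ , refl , _) → <⇒≱ 2≤n ≤-refl ; (node l [] , () , _) }
SISTdeg↔Fin n 2≤n (suc zero)    = empty↔Fin0 λ { (node l (_ ∷ []) , () , _) }
SISTdeg↔Fin n 2≤n (suc (suc j)) =
  ↔-trans (Bijection.SISTdeg↔Code (suc (suc j)) (s≤s (s≤s z≤n)) n) (Codes.Code↔Fin (suc (suc j)) n)

sumBelow : (ℕ → ℕ) → ℕ → ℕ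
sumBelow f zero    = 0
sumBelow f (suc r) = sumBelow f r + f r

sumBelow-scale : ∀ f g c r → (∀ d → d < r → f d ≡ c * g d) → sumBelow f r ≡ c * sumBelow g r
sumBelow-scale f g c zero    _     = sym (*-zeroʳ c)
sumBelow-scale f g c (suc r) f≡cg =
  trans (cong₂ _+_ (sumBelow-scale f g c r (λ d d<r → f≡cg d (m<n⇒m<1+n d<r))) (f≡cg r ≤-refl))
        (sym (*-distribˡ-+ c (sumBelow g r) (g r)))

module ByDegree (n : ℕ) where

  DegreeBelow : ℕ → Set
  DegreeBelow zero    = ⊥
  DegreeBelow (suc r) = DegreeBelow r ⊎ SISTdeg n r

  inject : ∀ r d → d < r → SISTdeg n d → DegreeBelow r
  inject (suc r) d d<r x with d ≟ r
  ... | yes refl = inj₂ x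
  ... | no  d≢r  = inj₁ (inject r d (≤∧≢⇒< (s≤s⁻¹ d<r) d≢r) x)

  forget : ∀ r → DegreeBelow r → SIST n
  forget (suc r) (inj₁ x)                  = forget r x
  forget (suc r) (inj₂ (t , ok , size , _)) = t , ok , size

  withDegree : (x : SIST n) → SISTdeg n (rootDegree (proj₁ x))
  withDegree (t , ok , size) = t , ok , size , refl

  forget-inject : ∀ r d d<r x → forget r (inject r d d<r x) ≡ (proj₁ x , proj₁ (proj₂ x) , proj₁ (proj₂ (proj₂ x)))
  forget-inject (suc r) d d<r x with d ≟ r
  ... | yes refl = refl
  ... | no  d≢r  = forget-inject r d _ x

  forget-degree< : ∀ r x → rootDegree (proj₁ (forget r x)) < r
  forget-degree< (suc r) (inj₁ x)                  = m<n⇒m<1+n (forget-degree< r x)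
  forget-degree< (suc r) (inj₂ (t , ok , size , deg)) = s≤s (≤-reflexive deg)

  inject-forget : ∀ r x d<r → inject r (rootDegree (proj₁ (forget r x))) d<r (withDegree (forget r x)) ≡ x
  inject-forget (suc r) (inj₁ x) d<r with rootDegree (proj₁ (forget r x)) ≟ r
  ... | yes d≡r = ⊥-elim (<-irrefl d≡r (forget-degree< r x))
  ... | no  _   = cong inj₁ (inject-forget r x _)
  inject-forget (suc .(rootDegree t)) (inj₂ (t , ok , size , refl)) d<r with rootDegree t ≟ rootDegree t
  ... | yes refl = refl
  ... | no  d≢d  = ⊥-elim (d≢d refl)

  SIST↔DegreeBelow : SIST n ↔ DegreeBelow (suc n)
  SIST↔DegreeBelow = mk↔ₛ′ to (forget (suc n)) (λ x → inject-forget (suc n) x _) (λ x → forget-inject (suc n) _ _ (withDegree x))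
    where
    to : SIST n → DegreeBelow (suc n)
    to (t , ok , size) = inject (suc n) (rootDegree t)
      (s≤s (subst (rootDegree t ≤_) size (rootDegree≤leaves t (schroder (toValid {t} ok))))) (t , ok , size , refl)

  DegreeBelow↔Fin : ∀ r (f : ℕ → ℕ) → (∀ d → SISTdeg n d ↔ Fin (f d)) → DegreeBelow r ↔ Fin (sumBelow f r)
  DegreeBelow↔Fin zero    f iso = empty↔Fin0 (λ ())
  DegreeBelow↔Fin (suc r) f iso = ↔-trans (DegreeBelow↔Fin r f iso ⊎-↔ iso r) (↔-sym +↔⊎)

total : ℕ → ℕ
total n = sumBelow (degreeCount n) (suc n)

SIST↔Fin : ∀ n → 2 ≤ n → SIST n ↔ Fin (total n)
SIST↔Fin n 2≤n = ↔-trans SIST↔DegreeBelow (DegreeBelow↔Fin (suc n) (degreeCount n) (SISTdeg↔Fin n 2≤n))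
  where open ByDegree n

-- Adding a leaf multiplies the count for each degree d < n by n+1 (a tree of degree n
-- with n+1 leaves arises in n ways, and degree n+1 only from the corolla).
degreeCount-step : ∀ n d → d < n → degreeCount (suc n) d ≡ suc n * degreeCount n d
degreeCount-step n zero          _   = sym (*-zeroʳ (suc n))
degreeCount-step n (suc zero)    _   = sym (*-zeroʳ (suc n))
degreeCount-step n (suc (suc j)) d<n = Codes.codes-step (suc (suc j)) n d<n

degreeCount-top : ∀ n → 2 ≤ n → degreeCount n n ≡ 1
degreeCount-top (suc zero)    (s≤s ())
degreeCount-top (suc (suc j)) _ = Codes.codes-k (suc (suc j))

degreeCount-next : ∀ n → 2 ≤ n → degreeCount (suc n) n ≡ n
degreeCount-next (suc zero)    (s≤s ())
degreeCount-next (suc (suc j)) _ = Codes.codes-suc-k (suc (suc j))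

total-step : ∀ n → 2 ≤ n → total (suc n) ≡ suc n * total n
total-step n 2≤n = begin
  sumBelow (degreeCount (suc n)) n + degreeCount (suc n) n + degreeCount (suc n) (suc n)
    ≡⟨ cong₂ _+_ (cong₂ _+_ (sumBelow-scale _ _ (suc n) n (degreeCount-step n)) (degreeCount-next n 2≤n))
                 (degreeCount-top (suc n) (m≤n⇒m≤1+n 2≤n)) ⟩
  suc n * S + n + 1
    ≡⟨ solve 2 (λ N s → (con 1 :+ N) :* s :+ N :+ con 1 := (con 1 :+ N) :* (s :+ con 1)) refl n S ⟩
  suc n * (S + 1)
    ≡⟨ cong (λ z → suc n * (S + z)) (sym (degreeCount-top n 2≤n)) ⟩
  suc n * total n ∎
  where
  open ≡-Reasoning
  S = sumBelow (degreeCount n) n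

degreeCount-closed : ∀ {n} k → 2 ≤ k → k < n → degreeCount n k * (suc k) ! ≡ k * n !
degreeCount-closed (suc zero)    (s≤s ()) _
degreeCount-closed (suc (suc j)) _ k<n = Codes.codes-closed (suc (suc j)) _ k<n

total-closed : ∀ n → 2 ≤ n → 2 * total n ≡ n !
total-closed (suc zero)          (s≤s ())
total-closed (suc (suc zero))    _ = refl
total-closed (suc (suc (suc m))) _ = begin
  2 * total (3 + m)             ≡⟨ cong (2 *_) (total-step (2 + m) (s≤s (s≤s z≤n))) ⟩
  2 * ((3 + m) * total (2 + m)) ≡⟨ solve 3 (λ a b c → a :* (b :* c) := b :* (a :* c)) refl 2 (3 + m) (total (2 + m)) ⟩
  (3 + m) * (2 * total (2 + m)) ≡⟨ cong ((3 + m) *_) (total-closed (suc (suc m)) (s≤s (s≤s z≤n))) ⟩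
  (3 + m) * (2 + m) ! ∎
  where open ≡-Reasoning

theorem2 : (n : ℕ) → 2 ≤ n →
    Σ ℕ (λ b → (SIST n ↔ Fin b)
    × ((k : ℕ) → 2 ≤ k → k ≤ n ∸ 1 →
    Σ ℕ (λ a → (SISTdeg n k ↔ Fin a) × a * (suc k) ! ≡ 2 * k * b))
    × Σ ℕ (λ a → (SISTdeg n n ↔ Fin a) × a * n ! ≡ 2 * b))
theorem2 n 2≤n =
  total n , SIST↔Fin n 2≤n ,
  (λ k 2≤k k≤n-1 →
     degreeCount n k , SISTdeg↔Fin n 2≤n k ,
     (begin
       degreeCount n k * (suc k) ! ≡⟨ degreeCount-closed k 2≤k (k<n k≤n-1) ⟩
       k * n !                     ≡⟨ cong (k *_) (sym (total-closed n 2≤n)) ⟩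
       k * (2 * total n)           ≡⟨ solve 2 (λ K b → K :* (con 2 :* b) := con 2 :* K :* b) refl k (total n) ⟩
       2 * k * total n ∎)) ,
  (degreeCount n n , SISTdeg↔Fin n 2≤n n ,
     trans (cong (_* n !) (degreeCount-top n 2≤n)) (trans (+-identityʳ (n !)) (sym (total-closed n 2≤n))))
  where
  open ≡-Reasoning
  k<n : ∀ {k} → k ≤ n ∸ 1 → k < n
  k<n k≤n-1 = ≤-trans (s≤s k≤n-1) (≤-reflexive (m+[n∸m]≡n (≤-trans (s≤s z≤n) 2≤n)))
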